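{- Every oriented tree is strongly chordal.
   Context: An oriented tree is a digraph (without loops) obtained from a finite tree by orienting each edge in one direction. A digraph is strongly chordal if the rows and columns of its adjacency matrix can be simultaneously permuted so that the result has no submatrix $\begin{pmatrix}1&1\\1&0\end{pmatrix}$, i.e. no rows $i<j$ and columns $k<\ell$ with entries $(i,k)=(i,\ell)=(j,k)=1$, $(j,\ell)=0$. -}

module Defs where

open import Data.Nat using (ℕ; _≤_)
open import Data.Fin using (Fin; _<_)
open import Data.Bool using (Bool; true; false; T)
open import Data.List using (List; []; _∷_; _++_; [_]; length)
open import Data.List.Relation.Unary.Linked using (Linked)
open import Data.List.Relation.Unary.Unique.Propositional using (Unique)
open import Data.Fin.Permutation using (Permutation′; _⟨$⟩ʳ_)
open import Data.Product using (Σ; _×_; ∃)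
open import Data.Sum using (_⊎_)
open import Data.Empty using (⊥)
open import Relation.Nullary using (¬_)
open import Relation.Binary.PropositionalEquality using (_≡_)

-- A (loopless) digraph on the vertex set Fin n, given by its adjacency matrix:
-- Adj u v ≡ true  iff there is an arc u → v.
Digraph : ℕ → Set
Digraph n = Fin n → Fin n → Bool

record Graph (n : ℕ) : Set₁ where
  field
    Edge  : Fin n → Fin n → Set
    sym   : ∀ {u v} → Edge u v → Edge v u
    irrefl : ∀ {u} → ¬ Edge u u
open Graph public

data Walk {n : ℕ} (G : Graph n) : Fin n → Fin n → Set where
  []  : ∀ {x} → Walk G x x
  _∷_ : ∀ {x y z} → Edge G x y → Walk G y z → Walk G x z

Connected : ∀ {n} → Graph n → Set
Connected G = ∀ u v → Walk G u v

IsCycle : ∀ {n} → Graph n → List (Fin n) → Set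
IsCycle G []       = ⊥
IsCycle G (v ∷ vs) =
  3 ≤ length (v ∷ vs) × Unique (v ∷ vs) × Linked (Edge G) ((v ∷ vs) ++ [ v ])

Acyclic : ∀ {n} → Graph n → Set
Acyclic G = ∀ cs → ¬ IsCycle G cs

IsTree : ∀ {n} → Graph n → Set
IsTree G = Connected G × Acyclic G

IsOrientationOf : ∀ {n} → Digraph n → Graph n → Set
IsOrientationOf {n} D G =
  (∀ u v → T (D u v) → Edge G u v) ×
  (∀ u v → Edge G u v → T (D u v) ⊎ T (D v u)) ×
  (∀ u v → T (D u v) → ¬ T (D v u))

IsOrientedTree : ∀ {n} → Digraph n → Set₁
IsOrientedTree {n} D = Σ (Graph n) λ G → IsTree G × IsOrientationOf D G

permuted : ∀ {n} → Permutation′ n → Digraph n → Digraph n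
permuted σ D i j = D (σ ⟨$⟩ʳ i) (σ ⟨$⟩ʳ j)

Γ-free : ∀ {n} → Digraph n → Set
Γ-free {n} M = ∀ (i j k l : Fin n) → i < j → k < l →
  M i k ≡ true → M i l ≡ true → M j k ≡ true → ¬ (M j l ≡ false)

StronglyChordal : ∀ {n} → Digraph n → Set
StronglyChordal {n} D = Σ (Permutation′ n) λ σ → Γ-free (permuted σ D)

-- Root the tree and list the vertices by decreasing depth. In a tree a vertex has at most
-- one neighbour that is not deeper than itself, its parent: a second one, or a neighbour
-- at the same depth, would close a cycle through a common ancestor. If a → c, a → e and
-- b → c with a listed before b and c before e, then whichever of a and c is the deeper
-- has two neighbours that are not deeper (a and b, resp. c and e), so a = b or c = e.
-- Hence the permuted matrix does not even contain the three ones of a Γ.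

module Submission where

open import Data.Bool using (T; true)
open import Data.Bool.Properties using (T-≡)
open import Data.Empty using (⊥; ⊥-elim)
open import Data.Fin as Fin using (Fin; toℕ; fromℕ<; punchOut)
import Data.Fin.Properties as Fin
open import Data.Fin.Permutation as Permutation using (Permutation′; _⟨$⟩ʳ_; permutation)
open import Data.Fin.Subset using (Subset; _∈_; _⊂_; ∣_∣)
open import Data.Fin.Subset.Properties using (⊆⊤; ∈⊤; p⊂q⇒∣p∣<∣q∣; ∣⊤∣≡n)
open import Data.List using (List; []; _∷_; _++_; [_]; length)
open import Data.List.Properties using (length-++)
open import Data.List.Relation.Unary.All as All using (All; []; _∷_)
import Data.List.Relation.Unary.All.Properties as All
open import Data.List.Relation.Unary.AllPairs using ([]; _∷_)
import Data.List.Relation.Unary.AllPairs.Properties as AllPairs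
open import Data.List.Relation.Unary.Linked using (Linked; [-]; _∷_)
open import Data.List.Relation.Unary.Unique.Propositional using (Unique)
open import Data.Nat as ℕ using (ℕ; zero; suc; z≤n; s≤s; _≤_)
import Data.Nat.Properties as ℕ
open import Data.Product using (Σ; ∃; _×_; _,_; proj₁; proj₂)
open import Data.Product.Relation.Binary.Lex.Strict using (×-Lex; ×-isStrictTotalOrder)
open import Data.Sum using (_⊎_; inj₁; inj₂; [_,_]′)
open import Data.Vec using (tabulate)
open import Data.Vec.Properties using (lookup∘tabulate; []=⇒lookup; lookup⇒[]=)
open import Function using (_∘_; _on_; Equivalence)
open import Function.Bundles using (Injection)
open import Function.Definitions using (Injective)
open import Function.Properties.Inverse using (↔⇒↣)
open import Level using (Level; 0ℓ)
open import Relation.Binary using (Rel; IsStrictTotalOrder; Tri; tri<; tri≈; tri>)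
import Relation.Binary.Construct.Flip.EqAndOrd as Flip
import Relation.Binary.Construct.On as On
open import Relation.Binary.PropositionalEquality as ≡
  using (_≡_; _≢_; refl; subst; subst₂; ≢-sym)
open import Relation.Binary.Structures.Biased using (IsStrictTotalOrderᶜ; isStrictTotalOrderᶜ)
open import Relation.Nullary using (Dec; yes; no; does)
open import Relation.Nullary.Decidable using (dec-true; T?; map′; _⊎-dec_; _×-dec_)
open import Relation.Nullary.Negation using (contradiction)
open import Relation.Unary using (Pred; Decidable)
open import Defs

least-witness : ∀ {p} {P : Pred ℕ p} → Decidable P →
                ∀ {m} → P m → ∃ λ n → P n × ∀ {k} → P k → n ≤ k
least-witness P? {zero} Pm = 0 , Pm , λ _ → z≤n
least-witness {P = P} P? {suc m} Pm with P? 0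
... | yes P0 = 0 , P0 , λ _ → z≤n
... | no ¬P0 with least-witness (P? ∘ suc) Pm
...   | n , Pn+1 , least = suc n , Pn+1 , least′
  where
  least′ : ∀ {k} → P k → suc n ≤ k
  least′ {zero}  P0 = contradiction P0 ¬P0
  least′ {suc k} Pk = s≤s (least Pk)

Linked-∷ʳ⁺ : ∀ {a r} {A : Set a} {R : Rel A r} (xs : List A) {x y} →
             Linked R (xs ++ [ x ]) → R x y → Linked R ((xs ++ [ x ]) ++ [ y ])
Linked-∷ʳ⁺ []           _          Rxy = Rxy ∷ [-]
Linked-∷ʳ⁺ (_ ∷ [])     (R₁ ∷ [-]) Rxy = R₁ ∷ Rxy ∷ [-]
Linked-∷ʳ⁺ (_ ∷ w ∷ ws) (R₁ ∷ Rws) Rxy = R₁ ∷ Linked-∷ʳ⁺ (w ∷ ws) Rws Rxy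

injective⇒surjective : ∀ {n} (f : Fin n → Fin n) → Injective _≡_ _≡_ f →
                       ∀ i → ∃ λ v → f v ≡ i
injective⇒surjective {suc n} f f-inj i with Fin.any? (λ v → f v Fin.≟ i)
... | yes hit = hit
... | no miss = contradiction (Fin.injective⇒≤ squeeze-injective) ℕ.1+n≰n
  where
  misses : ∀ v → i ≢ f v
  misses v i≡fv = miss (v , ≡.sym i≡fv)

  squeeze : Fin (suc n) → Fin n
  squeeze v = punchOut (misses v)

  squeeze-injective : Injective _≡_ _≡_ squeeze
  squeeze-injective {u} {v} = f-inj ∘ Fin.punchOut-injective (misses u) (misses v)

module Enumeration {n : ℕ} {ℓ : Level} {_≺_ : Rel (Fin n) ℓ}
                   (≺-sto : IsStrictTotalOrder _≡_ _≺_) where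
  open IsStrictTotalOrder ≺-sto
    using (compare; _<?_) renaming (trans to ≺-trans; irrefl to ≺-irrefl)

  predecessors : Fin n → Subset n
  predecessors v = tabulate (λ u → does (u <? v))

  ∈-predecessors⁺ : ∀ {u v} → u ≺ v → u ∈ predecessors v
  ∈-predecessors⁺ {u} {v} u≺v =
    lookup⇒[]= u _ (≡.trans (lookup∘tabulate _ u) (dec-true (u <? v) u≺v))

  ∈-predecessors⁻ : ∀ {u v} → u ∈ predecessors v → u ≺ v
  ∈-predecessors⁻ {u} {v} u∈
    with u <? v | ≡.trans (≡.sym (lookup∘tabulate _ u)) ([]=⇒lookup u∈)
  ... | yes u≺v | _ = u≺v

  predecessors-⊂ : ∀ {u v} → u ≺ v → predecessors u ⊂ predecessors v
  predecessors-⊂ u≺v =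
    (λ w∈ → ∈-predecessors⁺ (≺-trans (∈-predecessors⁻ w∈) u≺v)) ,
    _ , ∈-predecessors⁺ u≺v , ≺-irrefl refl ∘ ∈-predecessors⁻

  ∣predecessors∣<n : ∀ v → ∣ predecessors v ∣ ℕ.< n
  ∣predecessors∣<n v = subst (∣ predecessors v ∣ ℕ.<_) (∣⊤∣≡n n)
    (p⊂q⇒∣p∣<∣q∣ (⊆⊤ , v , ∈⊤ , ≺-irrefl refl ∘ ∈-predecessors⁻))

  rank : Fin n → Fin n
  rank v = fromℕ< (∣predecessors∣<n v)

  rank-mono : ∀ {u v} → u ≺ v → rank u Fin.< rank v
  rank-mono {u} {v} u≺v = begin-strict
    toℕ (rank u)           ≡⟨ Fin.toℕ-fromℕ< _ ⟩
    ∣ predecessors u ∣     <⟨ p⊂q⇒∣p∣<∣q∣ (predecessors-⊂ u≺v) ⟩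
    ∣ predecessors v ∣     ≡⟨ Fin.toℕ-fromℕ< _ ⟨
    toℕ (rank v)           ∎
    where open ℕ.≤-Reasoning

  rank-injective : Injective _≡_ _≡_ rank
  rank-injective {u} {v} ranks≡ with compare u v
  ... | tri< u≺v _ _ = contradiction ranks≡ (Fin.<⇒≢ (rank-mono u≺v))
  ... | tri≈ _ u≡v _ = u≡v
  ... | tri> _ _ v≺u = contradiction (≡.sym ranks≡) (Fin.<⇒≢ (rank-mono v≺u))

  enumeration : Σ (Permutation′ n) λ σ → ∀ {i j} → i Fin.< j → (σ ⟨$⟩ʳ i) ≺ (σ ⟨$⟩ʳ j)
  enumeration = σ , σ-increasing
    where
    ranked : ∀ i → ∃ λ v → rank v ≡ i
    ranked = injective⇒surjective rank rank-injective

    σ : Permutation′ n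
    σ = permutation (proj₁ ∘ ranked) rank
      (λ v → rank-injective (proj₂ (ranked (rank v)))) (proj₂ ∘ ranked)

    σ-increasing : ∀ {i j} → i Fin.< j → (σ ⟨$⟩ʳ i) ≺ (σ ⟨$⟩ʳ j)
    σ-increasing {i} {j} i<j with compare (σ ⟨$⟩ʳ i) (σ ⟨$⟩ʳ j)
    ... | tri< σi≺σj _ _ = σi≺σj
    ... | tri≈ _ σi≡σj _ = contradiction (Injection.injective (↔⇒↣ σ) σi≡σj) (Fin.<⇒≢ i<j)
    ... | tri> _ _ σj≺σi = contradiction
      (subst₂ (λ a b → a Fin.< b) (proj₂ (ranked j)) (proj₂ (ranked i)) (rank-mono σj≺σi))
      (Fin.<-asym i<j)

keyed : ∀ {n} → (Fin n → ℕ) → Fin n → ℕ × Fin n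
keyed key v = key v , v

ByDecreasing : ∀ {n} → (Fin n → ℕ) → Rel (Fin n) 0ℓ
ByDecreasing key = ×-Lex _≡_ ℕ._>_ Fin._<_ on keyed key

module _ {n} (key : Fin n → ℕ) where
  private
    module Lex = IsStrictTotalOrder (On.isStrictTotalOrder (keyed key)
      (×-isStrictTotalOrder (Flip.isStrictTotalOrder ℕ.<-isStrictTotalOrder) Fin.<-isStrictTotalOrder))

    ≡⇒pointwise : ∀ {u v} → u ≡ v → key u ≡ key v × u ≡ v
    ≡⇒pointwise refl = refl , refl

    compare : ∀ u v → Tri (ByDecreasing key u v) (u ≡ v) (ByDecreasing key v u)
    compare u v with Lex.compare u v
    ... | tri< u≺v u≉v v⊀u        = tri< u≺v (u≉v ∘ ≡⇒pointwise) v⊀u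
    ... | tri≈ u⊀v (_ , u≡v) v⊀u = tri≈ u⊀v u≡v v⊀u
    ... | tri> u⊀v u≉v v≺u        = tri> u⊀v (u≉v ∘ ≡⇒pointwise) v≺u

    byDecreasing-isStrictTotalOrderᶜ : IsStrictTotalOrderᶜ _≡_ (ByDecreasing key)
    byDecreasing-isStrictTotalOrderᶜ .IsStrictTotalOrderᶜ.isEquivalence = ≡.isEquivalence
    byDecreasing-isStrictTotalOrderᶜ .IsStrictTotalOrderᶜ.trans         = Lex.trans
    byDecreasing-isStrictTotalOrderᶜ .IsStrictTotalOrderᶜ.compare       = compare

  byDecreasing-isStrictTotalOrder : IsStrictTotalOrder _≡_ (ByDecreasing key)
  byDecreasing-isStrictTotalOrder = isStrictTotalOrderᶜ byDecreasing-isStrictTotalOrderᶜ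

antitone-enumeration : ∀ {n} (key : Fin n → ℕ) →
  Σ (Permutation′ n) λ σ → ∀ {i j} → i Fin.< j → key (σ ⟨$⟩ʳ j) ℕ.≤ key (σ ⟨$⟩ʳ i)
antitone-enumeration key =
  let σ , σ-increasing = Enumeration.enumeration (byDecreasing-isStrictTotalOrder key)
  in  σ , λ i<j → ≺⇒≥ (σ-increasing i<j)
  where
  ≺⇒≥ : ∀ {u v} → ByDecreasing key u v → key v ℕ.≤ key u
  ≺⇒≥ (inj₁ v<u) = ℕ.<⇒≤ v<u
  ≺⇒≥ (inj₂ (u≡v , _)) = ℕ.≤-reflexive (≡.sym u≡v)

AtMostOneNeighbourBelow : ∀ {n} → Graph n → (Fin n → ℕ) → Set
AtMostOneNeighbourBelow G h =
  ∀ {u v w} → Edge G u v → Edge G w v → h u ≤ h v → h w ≤ h v → u ≡ w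

Γ-pattern-degenerate : ∀ {n} {G : Graph n} {h : Fin n → ℕ} → AtMostOneNeighbourBelow G h →
  ∀ {a b c e} → Edge G a c → Edge G a e → Edge G b c → h b ≤ h a → h e ≤ h c →
  a ≡ b ⊎ c ≡ e
Γ-pattern-degenerate {G = G} {h} unique {a} {c = c} ac ae bc hb≤ha he≤hc
  with ℕ.≤-total (h a) (h c)
... | inj₁ ha≤hc = inj₁ (unique ac bc ha≤hc (ℕ.≤-trans hb≤ha ha≤hc))
... | inj₂ hc≤ha =
  inj₂ (unique (Graph.sym G ac) (Graph.sym G ae) hc≤ha (ℕ.≤-trans he≤hc hc≤ha))

Γ-free-by-decreasing-height : ∀ {n} {D : Digraph n} {G : Graph n} {h : Fin n → ℕ} →
  (∀ u v → T (D u v) → Edge G u v) → AtMostOneNeighbourBelow G h →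
  (σ : Permutation′ n) → (∀ {i j} → i Fin.< j → h (σ ⟨$⟩ʳ j) ≤ h (σ ⟨$⟩ʳ i)) →
  Γ-free (permuted σ D)
Γ-free-by-decreasing-height {D = D} {G} {h} arc⇒edge unique σ antitone
  i j k l i<j k<l ik il jk _
  with Γ-pattern-degenerate {G = G} {h} unique (edge ik) (edge il) (edge jk)
         (antitone i<j) (antitone k<l)
  where
  edge : ∀ {u v} → D u v ≡ true → Edge G u v
  edge = arc⇒edge _ _ ∘ Equivalence.from T-≡
... | inj₁ σi≡σj = Fin.<⇒≢ i<j (Injection.injective (↔⇒↣ σ) σi≡σj)
... | inj₂ σk≡σl = Fin.<⇒≢ k<l (Injection.injective (↔⇒↣ σ) σk≡σl)

module BreadthFirst {n} (G : Graph n) (edge? : ∀ u v → Dec (Edge G u v))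
                    (root : Fin n) (connected : Connected G) where

  Within : ℕ → Fin n → Set
  Within zero    v = v ≡ root
  Within (suc t) v = Within t v ⊎ ∃ λ u → Within t u × Edge G u v

  within? : ∀ t v → Dec (Within t v)
  within? zero    v = v Fin.≟ root
  within? (suc t) v = within? t v ⊎-dec Fin.any? (λ u → within? t u ×-dec edge? u v)

  within-walk : ∀ {t u v} → Within t u → Walk G u v → ∃ λ s → Within s v
  within-walk {t} u∈ []      = t , u∈
  within-walk     u∈ (e ∷ w) = within-walk (inj₂ (_ , u∈ , e)) w

  depth-spec : ∀ v → ∃ λ d → Within d v × ∀ {k} → Within k v → d ≤ k
  depth-spec v = least-witness (λ t → within? t v) (proj₂ (within-walk refl (connected root v)))

  depth : Fin n → ℕ
  depth v = proj₁ (depth-spec v)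

  within-depth : ∀ v → Within (depth v) v
  within-depth v = proj₁ (proj₂ (depth-spec v))

  depth-minimal : ∀ {k v} → Within k v → depth v ≤ k
  depth-minimal {v = v} = proj₂ (proj₂ (depth-spec v))

  depth-edge : ∀ {u v} → Edge G u v → depth v ≤ suc (depth u)
  depth-edge e = depth-minimal (inj₂ (_ , within-depth _ , e))

  depth≡0⇒root : ∀ {v} → depth v ≡ 0 → v ≡ root
  depth≡0⇒root {v} d≡0 = subst (λ t → Within t v) d≡0 (within-depth v)

  parent : ∀ {t v} → depth v ≡ suc t → ∃ λ u → depth u ≡ t × Edge G u v
  parent {t} {v} dv≡ with subst (λ s → Within s v) dv≡ (within-depth v)
  ... | inj₁ v∈ = contradiction (subst (_≤ t) dv≡ (depth-minimal v∈)) ℕ.1+n≰n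
  ... | inj₂ (u , u∈ , e) = u , ℕ.≤-antisym (depth-minimal u∈) t≤du , e
    where
    t≤du : t ≤ depth u
    t≤du = ℕ.s≤s⁻¹ (subst (_≤ suc (depth u)) dv≡ (depth-edge e))

  below⇒≢ : ∀ {t u w} → depth u ≡ t → t ℕ.< depth w → u ≢ w
  below⇒≢ du≡t t<dw refl = ℕ.<-irrefl (≡.sym du≡t) t<dw

  module _ (acyclic : Acyclic G) where

    -- Lifting both ends to their parents either meets in a common parent, closing a
    -- cycle, or gives a longer such path one level up.
    no-detour : ∀ t {x z} (W : List (Fin n)) → depth x ≡ t → depth z ≡ t →
                All (λ w → t ≤ depth w) (x ∷ W ++ [ z ]) →
                Unique (x ∷ W ++ [ z ]) → Linked (Edge G) (x ∷ W ++ [ z ]) → ⊥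
    no-detour zero W dx≡0 dz≡0 _ (x∉ ∷ _) _ =
      proj₂ (All.∷ʳ⁻ x∉) (≡.trans (depth≡0⇒root dx≡0) (≡.sym (depth≡0⇒root dz≡0)))
    no-detour (suc t) {x} {z} W dx≡ dz≡ deep unique linked
      with parent dx≡ | parent dz≡
    ... | px , dpx≡ , px-x | pz , dpz≡ , pz-z with px Fin.≟ pz
    ...   | yes refl = acyclic (px ∷ x ∷ W ++ [ z ])
              ( s≤s (s≤s (subst (1 ≤_) (≡.sym (length-++ W)) (ℕ.m≤n+m 1 (length W))))
              , All.map (below⇒≢ dpx≡) deep ∷ unique
              , px-x ∷ Linked-∷ʳ⁺ (x ∷ W) linked (Graph.sym G pz-z))
    ...   | no px≢pz = no-detour t (x ∷ W ++ [ z ]) dpx≡ dpz≡ deep′ unique′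
              (px-x ∷ Linked-∷ʳ⁺ (x ∷ W) linked (Graph.sym G pz-z))
      where
      deep′ : All (λ w → t ≤ depth w) (px ∷ (x ∷ W ++ [ z ]) ++ [ pz ])
      deep′ = ℕ.≤-reflexive (≡.sym dpx≡)
            ∷ All.∷ʳ⁺ (All.map ℕ.<⇒≤ deep) (ℕ.≤-reflexive (≡.sym dpz≡))
      unique′ : Unique (px ∷ (x ∷ W ++ [ z ]) ++ [ pz ])
      unique′ = All.∷ʳ⁺ (All.map (below⇒≢ dpx≡) deep) px≢pz
              ∷ AllPairs.++⁺ unique ([] ∷ [])
                  (All.map (λ t<dw → ≢-sym (below⇒≢ dpz≡ t<dw) ∷ []) deep)

    edge⇒depth≢ : ∀ {u v} → Edge G u v → depth u ≢ depth v
    edge⇒depth≢ {u} {v} e du≡dv = no-detour (depth u) [] refl (≡.sym du≡dv)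
      (ℕ.≤-refl ∷ ℕ.≤-reflexive du≡dv ∷ [])
      ((u≢v ∷ []) ∷ [] ∷ [])
      (e ∷ [-])
      where
      u≢v : u ≢ v
      u≢v refl = Graph.irrefl G e

    lower-neighbour-is-parent : ∀ {u v} → Edge G u v → depth u ≤ depth v →
                                depth v ≡ suc (depth u)
    lower-neighbour-is-parent e du≤dv =
      ℕ.≤-antisym (depth-edge e) (ℕ.≤∧≢⇒< du≤dv (edge⇒depth≢ e))

    parent-unique : ∀ {u v w} → Edge G u v → Edge G w v →
                    depth v ≡ suc (depth u) → depth v ≡ suc (depth w) → u ≡ w
    parent-unique {u} {v} {w} uv wv dv≡ dv≡′ with u Fin.≟ w
    ... | yes u≡w = u≡w
    ... | no u≢w = ⊥-elim (no-detour (depth u) (v ∷ []) refl dw≡du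
        (ℕ.≤-refl ∷ ℕ.<⇒≤ du<dv ∷ ℕ.≤-reflexive (≡.sym dw≡du) ∷ [])
        ((below⇒≢ refl du<dv ∷ u≢w ∷ []) ∷ (≢-sym (below⇒≢ dw≡du du<dv) ∷ []) ∷ [] ∷ [])
        (uv ∷ Graph.sym G wv ∷ [-]))
      where
      dw≡du : depth w ≡ depth u
      dw≡du = ℕ.suc-injective (≡.trans (≡.sym dv≡′) dv≡)
      du<dv : depth u ℕ.< depth v
      du<dv = ℕ.≤-reflexive (≡.sym dv≡)

    depth-atMostOneNeighbourBelow : AtMostOneNeighbourBelow G depth
    depth-atMostOneNeighbourBelow uv wv du≤dv dw≤dv =
      parent-unique uv wv (lower-neighbour-is-parent uv du≤dv)
                          (lower-neighbour-is-parent wv dw≤dv)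

orientation-edge? : ∀ {n} {D : Digraph n} {G : Graph n} → IsOrientationOf D G →
                    ∀ u v → Dec (Edge G u v)
orientation-edge? {D = D} {G} (arc⇒edge , edge⇒arc , _) u v =
  map′ [ arc⇒edge u v , Graph.sym G ∘ arc⇒edge v u ]′ (edge⇒arc u v) (T? (D u v) ⊎-dec T? (D v u))

corollary24 : ∀ (n : ℕ) (D : Digraph n) → IsOrientedTree D → StronglyChordal D
corollary24 zero    D _ = Permutation.id , λ ()
corollary24 (suc m) D (G , (connected , acyclic) , orientation) =
  let σ , antitone = antitone-enumeration depth
  in  σ , Γ-free-by-decreasing-height {G = G} (proj₁ orientation)
              (depth-atMostOneNeighbourBelow acyclic) σ antitone
  where
  open BreadthFirst G (orientation-edge? {D = D} {G} orientation) Fin.zero connected
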